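{- Let $X$ be a nominal set and let $f\in X^{\mathbb V}$, i.e. $f:\mathbb V\to X$ is finitely supported. Write $\mathrm{supp}(f)=\{v_1,\dots,v_n\}$ (distinct), $\vec v=(v_1,\dots,v_n)$, $f(\vec v)=(f(v_1),\dots,f(v_n))$, and let $a\in\mathbb V\setminus\mathrm{supp}(f)$. Then $q_X(a,f(a),\vec v,f(\vec v))=f$. Consequently each component $q_X:FX\to X^{\mathbb V}$ is surjective.
   Context: $\mathbb V$ is a fixed infinite set of atoms; nominal sets are sets with an action of the group of finite permutations of $\mathbb V$ in which every element has a finite support ($\mathrm{supp}$ = least support); $(a\ b)$ denotes a transposition. $X^{\mathbb V}$ is the set of maps $\mathbb V\to X$ that are finitely supported w.r.t. $(\pi\star f)(y)=\pi\cdot f(\pi^{ -1}(y))$. Let $FX=\mathbb V\times X\times\coprod_{n\in\mathbb N}\mathbb V^n\times X^n$, and define $q_X:FX\to X^{\mathbb V}$ by $q_X(a,d,\vec v,\vec x)(b)=x_i$ where $i$ is minimal with $v_i=b$, and $q_X(a,d,\vec v,\vec x)(b)=(a\ b)\cdot d$ if no such $i$ exists. -}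

module Defs where

open import Data.Nat using (ℕ; _≟_)
open import Data.List using (List; []; _∷_; _++_)
open import Data.List.Membership.Propositional using (_∈_; _∉_)
open import Data.List.Membership.Propositional.Properties using (∈-++⁺ˡ; ∈-++⁺ʳ)
open import Data.List.Relation.Unary.Any using (here; there)
open import Data.Vec using (Vec; []; _∷_)
open import Data.Product using (Σ; ∃; _×_; _,_)
open import Data.Maybe using (Maybe; just; nothing; maybe)
open import Function using (id; _∘_)
open import Relation.Nullary using (yes; no; ¬_)
open import Relation.Binary.PropositionalEquality using (_≡_; refl; sym; trans; cong)

-- Atoms: the fixed infinite set 𝕍 is taken to be ℕ (decidable equality).
Atom : Set
Atom = ℕ

record Perm : Set where
  field
    to      : Atom → Atom
    from    : Atom → Atom
    to-from : ∀ x → to (from x) ≡ x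
    from-to : ∀ x → from (to x) ≡ x
    dom     : List Atom
    fix     : ∀ x → x ∉ dom → to x ≡ x
open Perm public

idPerm : Perm
idPerm = record { to = id ; from = id ; to-from = λ _ → refl ; from-to = λ _ → refl
                ; dom = [] ; fix = λ _ _ → refl }

_∘ₚ_ : Perm → Perm → Perm
π ∘ₚ σ = record
  { to = to π ∘ to σ
  ; from = from σ ∘ from π
  ; to-from = λ x → trans (cong (to π) (to-from σ (from π x))) (to-from π x)
  ; from-to = λ x → trans (cong (from σ) (from-to π (to σ x))) (from-to σ x)
  ; dom = dom π ++ dom σ
  ; fix = λ x x∉ → trans (cong (to π) (fix σ x (λ m → x∉ (∈-++⁺ʳ (dom π) m))))
                         (fix π x (λ m → x∉ (∈-++⁺ˡ m)))
  }

swapFn : Atom → Atom → Atom → Atom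
swapFn a b c with c ≟ a
... | yes _ = b
... | no _ with c ≟ b
...   | yes _ = a
...   | no _ = c

private
  swapFn-fix : ∀ a b c → ¬ c ≡ a → ¬ c ≡ b → swapFn a b c ≡ c
  swapFn-fix a b c p q with c ≟ a
  ... | yes e = Data.Empty.⊥-elim (p e)
    where import Data.Empty
  ... | no _ with c ≟ b
  ...   | yes e = Data.Empty.⊥-elim (q e)
    where import Data.Empty
  ...   | no _ = refl

  swapFn-a : ∀ a b → swapFn a b a ≡ b
  swapFn-a a b with a ≟ a
  ... | yes _ = refl
  ... | no ne = Data.Empty.⊥-elim (ne refl)
    where import Data.Empty

  swapFn-b : ∀ a b → swapFn a b b ≡ a
  swapFn-b a b with b ≟ a
  ... | yes e = e
  ... | no _ with b ≟ b
  ...   | yes _ = refl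
  ...   | no ne = Data.Empty.⊥-elim (ne refl)
    where import Data.Empty

  swapFn-inv : ∀ a b c → swapFn a b (swapFn a b c) ≡ c
  swapFn-inv a b c with c ≟ a
  ... | yes refl = swapFn-b c b
  ... | no p with c ≟ b
  ...   | yes refl = swapFn-a a c
  ...   | no q = swapFn-fix a b c p q

  swap-dom : ∀ a b c → c ∉ (a ∷ b ∷ []) → swapFn a b c ≡ c
  swap-dom a b c c∉ = swapFn-fix a b c (λ e → c∉ (here e)) (λ e → c∉ (there (here e)))

swap : Atom → Atom → Perm
swap a b = record { to = swapFn a b ; from = swapFn a b
                  ; to-from = swapFn-inv a b ; from-to = swapFn-inv a b
                  ; dom = a ∷ b ∷ [] ; fix = swap-dom a b }

Fixes : Perm → List Atom → Set
Fixes π A = ∀ a → a ∈ A → to π a ≡ a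

Supports : {X : Set} → (Perm → X → X) → List Atom → X → Set
Supports act A x = ∀ π → Fixes π A → act π x ≡ x

record Nominal : Set₁ where
  field
    Carrier  : Set
    act      : Perm → Carrier → Carrier
    act-id   : ∀ x → act idPerm x ≡ x
    act-∘    : ∀ π σ x → act (π ∘ₚ σ) x ≡ act π (act σ x)
    act-cong : ∀ π σ → (∀ a → to π a ≡ to σ a) → ∀ x → act π x ≡ act σ x
    finSupp  : ∀ x → ∃ λ A → Supports act A x
open Nominal public

module _ (X : Nominal) where
  -- Action on maps 𝕍 → X: (π ⋆ f)(y) = π · f(π⁻¹ y); equality of maps is pointwise.
  SupportsFun : List Atom → (Atom → Carrier X) → Set
  SupportsFun A f = ∀ π → Fixes π A → ∀ y → act X π (f (from π y)) ≡ f y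

  FinSuppFun : (Atom → Carrier X) → Set
  FinSuppFun f = ∃ λ A → SupportsFun A f

  IsSuppFun : (Atom → Carrier X) → List Atom → Set
  IsSuppFun f vs = SupportsFun vs f × (∀ A → SupportsFun A f → ∀ a → a ∈ vs → a ∈ A)

  F : Set
  F = Atom × Carrier X × Σ ℕ (λ n → Vec Atom n × Vec (Carrier X) n)

  firstMatch : ∀ {n} → Vec Atom n → Vec (Carrier X) n → Atom → Maybe (Carrier X)
  firstMatch [] [] b = nothing
  firstMatch (v ∷ vs) (x ∷ xs) b with v ≟ b
  ... | yes _ = just x
  ... | no _ = firstMatch vs xs b

  q : F → Atom → Carrier X
  q (a , d , n , vs , xs) b = maybe id (act X (swap a b) d) (firstMatch vs xs b)

-- Off its support, f is determined by any one fresh value: if a, b ∉ supp f then the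
-- transposition (a b) fixes supp f, so f b = (a b) · f ((a b) b) = (a b) · f a.  On the
-- support, q reads f off the table (v⃗, f v⃗).
module Submission where

open import Defs
open import Data.Nat using (ℕ; suc; s≤s; _≟_)
open import Data.Nat.Properties using (n≮n)
open import Data.List using (List)
open import Data.List.Extrema.Nat using (max; xs≤max)
open import Data.List.Membership.Propositional using (_∈_; _∉_)
open import Data.List.Membership.DecPropositional _≟_ using (_∈?_)
open import Data.List.Relation.Unary.All using (lookup)
open import Data.List.Relation.Unary.Any using (here; there)
open import Data.List.Relation.Unary.Unique.Propositional using (Unique)
open import Data.Vec using (Vec; []; _∷_; toList; fromList; map)
open import Data.Vec.Properties using (toList∘fromList)
open import Data.Product using (Σ; _×_; _,_; proj₁)
open import Data.Maybe using (just; nothing)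
open import Data.Empty using (⊥-elim)
open import Function using (_∘_)
open import Relation.Nullary using (yes; no)
open import Relation.Binary.PropositionalEquality
  using (_≡_; _≢_; refl; sym; cong; subst; module ≡-Reasoning)

swapFn-≢ : ∀ a b c → c ≢ a → c ≢ b → swapFn a b c ≡ c
swapFn-≢ a b c c≢a c≢b with c ≟ a
... | yes c≡a = ⊥-elim (c≢a c≡a)
... | no _ with c ≟ b
...   | yes c≡b = ⊥-elim (c≢b c≡b)
...   | no _ = refl

swapFn-right : ∀ a b → swapFn a b b ≡ a
swapFn-right a b with b ≟ a
... | yes b≡a = b≡a
... | no _ with b ≟ b
...   | yes _ = refl
...   | no b≢b = ⊥-elim (b≢b refl)

swap-fixes : ∀ {a b} (A : List Atom) → a ∉ A → b ∉ A → Fixes (swap a b) A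
swap-fixes {a} {b} A a∉A b∉A c c∈A =
  swapFn-≢ a b c (λ c≡a → a∉A (subst (_∈ A) c≡a c∈A)) (λ c≡b → b∉A (subst (_∈ A) c≡b c∈A))

suc-max-∉ : (A : List Atom) → suc (max 0 A) ∉ A
suc-max-∉ A m = n≮n _ (s≤s (lookup (xs≤max 0 A) m))

module _ (X : Nominal) (f : Atom → Carrier X) where

  firstMatch-map-∈ : ∀ {n} (vs : Vec Atom n) {b} → b ∈ toList vs
                   → firstMatch X vs (map f vs) b ≡ just (f b)
  firstMatch-map-∈ (v ∷ vs) {b} b∈ with v ≟ b
  firstMatch-map-∈ (v ∷ vs) _          | yes refl = refl
  firstMatch-map-∈ (v ∷ vs) (here b≡v) | no v≢b   = ⊥-elim (v≢b (sym b≡v))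
  firstMatch-map-∈ (v ∷ vs) (there b∈) | no _     = firstMatch-map-∈ vs b∈

  firstMatch-map-∉ : ∀ {n} (vs : Vec Atom n) {b} → b ∉ toList vs
                   → firstMatch X vs (map f vs) b ≡ nothing
  firstMatch-map-∉ []       b∉ = refl
  firstMatch-map-∉ (v ∷ vs) {b} b∉ with v ≟ b
  ... | yes refl = ⊥-elim (b∉ (here refl))
  ... | no _     = firstMatch-map-∉ vs (λ b∈ → b∉ (there b∈))

  fresh-swap-value : (A : List Atom) → SupportsFun X A f → ∀ {a b} → a ∉ A → b ∉ A
                   → act X (swap a b) (f a) ≡ f b
  fresh-swap-value A supp {a} {b} a∉A b∉A = begin
    act X (swap a b) (f a)                  ≡⟨ cong (act X (swap a b) ∘ f) (sym (swapFn-right a b)) ⟩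
    act X (swap a b) (f (swapFn a b b))     ≡⟨ supp (swap a b) (swap-fixes A a∉A b∉A) b ⟩
    f b                                     ∎
    where open ≡-Reasoning

  q-tabulate-support : ∀ {n} (vs : Vec Atom n) → SupportsFun X (toList vs) f
                     → ∀ {a} → a ∉ toList vs → ∀ b → q X (a , f a , n , vs , map f vs) b ≡ f b
  q-tabulate-support vs supp a∉ b with b ∈? toList vs
  ... | yes b∈ rewrite firstMatch-map-∈ vs b∈ = refl
  ... | no  b∉ rewrite firstMatch-map-∉ vs b∉ = fresh-swap-value (toList vs) supp a∉ b∉

  q-surjective : FinSuppFun X f → Σ (F X) (λ e → ∀ b → q X e b ≡ f b)
  q-surjective (A , supp) =
    (a , f a , _ , vs , map f vs) , q-tabulate-support vs supp′ a∉
    where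
    vs : Vec Atom _
    vs = fromList A
    a : Atom
    a = suc (max 0 A)
    supp′ : SupportsFun X (toList vs) f
    supp′ = subst (λ B → SupportsFun X B f) (sym (toList∘fromList A)) supp
    a∉ : a ∉ toList vs
    a∉ = subst (a ∉_) (sym (toList∘fromList A)) (suc-max-∉ A)

lemma27 : (X : Nominal)
    → ((f : Atom → Carrier X) → FinSuppFun X f
        → (n : ℕ) (vs : Vec Atom n) → Unique (toList vs) → IsSuppFun X f (toList vs)
        → (a : Atom) → a ∉ toList vs
        → ∀ b → q X (a , f a , n , vs , map f vs) b ≡ f b)
    × ((f : Atom → Carrier X) → FinSuppFun X f
        → Σ (F X) (λ e → ∀ b → q X e b ≡ f b))
lemma27 X =
    (λ f _ n vs _ isSupp a a∉ → q-tabulate-support X f vs (proj₁ isSupp) a∉)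
  , (λ f → q-surjective X f)
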